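{- For every integer $n\ge 0$, $NCM_2(2n)=s_n$, where $s_n$ is the $n$-th little Schröder number.
   Context: A (complete) matching of $[m]=\{1,\dots,m\}$ is a set partition of $[m]$ all of whose blocks have size $2$; its edges are its blocks $\{i,j\}$ written as pairs $(i,j)$ with $i<j$. For a nonnegative integer $k$, a $k$-distant crossing of a matching is a pair of edges $(i_1,j_1),(i_2,j_2)$ with $i_1<i_2\le j_1<j_2$ and $j_1-i_2\ge k$. A matching is $k$-distant noncrossing if it has no $k$-distant crossing. $NCM_k(m)$ denotes the number of $k$-distant noncrossing matchings of $[m]$. The little Schröder number $s_n$ (OEIS A001003: $1,1,3,11,45,197,\dots$) is the number of lattice paths from $(0,0)$ to $(2n,0)$ with steps $(1,1)$, $(1,-1)$, $(2,0)$ that never go below the $x$-axis and have no $(2,0)$ step on the $x$-axis. -}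

module Defs where

open import Data.Nat using (ℕ; zero; suc; _+_; _∸_; _≤?_; _<?_; _≟_)
open import Data.Bool using (Bool; true; false; _∧_; not; if_then_else_)
open import Data.Fin using (Fin; toℕ)
open import Data.Fin.Properties using () renaming (_≟_ to _≟ᶠ_)
open import Data.List using (List; []; _∷_; map; concatMap; length; filterᵇ; upTo; allFin)
open import Data.Bool.ListAction using (all; any)
open import Data.Vec using (Vec; lookup) renaming ([] to []ᵛ; _∷_ to _∷ᵛ_)
open import Relation.Nullary.Decidable using (⌊_⌋)

-- The points 1..m are represented by Fin m (point i+1 ↔ index i; this
-- shift is order preserving and preserves differences).  A candidate
-- matching is a vector v : Vec (Fin m) m, read as the map i ↦ v[i]
-- ("the partner of i").  It is a (complete) matching iff this map is a
-- fixed-point-free involution; its edges are the pairs (i , v[i]) with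
-- i < v[i].  Every matching of [m] corresponds to exactly one such v.

allVecs : (k m : ℕ) → List (Vec (Fin k) m)
allVecs k zero    = []ᵛ ∷ []
allVecs k (suc m) = concatMap (λ x → map (x ∷ᵛ_) (allVecs k m)) (allFin k)

isMatching : {m : ℕ} → Vec (Fin m) m → Bool
isMatching {m} v =
  all (λ i → ⌊ lookup v (lookup v i) ≟ᶠ i ⌋ ∧ not ⌊ lookup v i ≟ᶠ i ⌋) (allFin m)

kDistantCrossingAt : {m : ℕ} → ℕ → Vec (Fin m) m → Fin m → Fin m → Bool
kDistantCrossingAt k v a b =
  let i1 = toℕ a ; j1 = toℕ (lookup v a)
      i2 = toℕ b ; j2 = toℕ (lookup v b)
  in ⌊ i1 <? j1 ⌋ ∧ ⌊ i2 <? j2 ⌋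
     ∧ ⌊ i1 <? i2 ⌋ ∧ ⌊ i2 ≤? j1 ⌋ ∧ ⌊ j1 <? j2 ⌋
     ∧ ⌊ k ≤? j1 ∸ i2 ⌋                      -- j1 - i2 ≥ k (here i2 ≤ j1)

hasKDistantCrossing : {m : ℕ} → ℕ → Vec (Fin m) m → Bool
hasKDistantCrossing {m} k v =
  any (λ a → any (λ b → kDistantCrossingAt k v a b) (allFin m)) (allFin m)

isKNoncrossingMatching : {m : ℕ} → ℕ → Vec (Fin m) m → Bool
isKNoncrossingMatching k v = isMatching v ∧ not (hasKDistantCrossing k v)

NCM : ℕ → ℕ → ℕ
NCM k m = length (filterᵇ (isKNoncrossingMatching k) (allVecs m m))

-- Little Schröder numbers, as counts of lattice paths

-- U = (1,1), D = (1,-1), H = (2,0)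
data Step : Set where
  U D H : Step

width : List Step → ℕ
width []      = 0
width (U ∷ p) = suc (width p)
width (D ∷ p) = suc (width p)
width (H ∷ p) = suc (suc (width p))

-- starting at height h: never goes below the x-axis, no H step on the
-- x-axis, and ends on the x-axis
validFrom : ℕ → List Step → Bool
validFrom zero    []      = true
validFrom (suc h) []      = false
validFrom h       (U ∷ p) = validFrom (suc h) p
validFrom zero    (D ∷ p) = false
validFrom (suc h) (D ∷ p) = validFrom h p
validFrom zero    (H ∷ p) = false
validFrom (suc h) (H ∷ p) = validFrom (suc h) p

words : ℕ → List (List Step)
words zero    = [] ∷ []
words (suc l) = concatMap (λ s → map (s ∷_) (words l)) (U ∷ D ∷ H ∷ [])

-- every step has width ≥ 1, so a path of width 2n has length ≤ 2n;
-- sequences of different lengths are different, so no path is counted twice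
candidates : ℕ → List (List Step)
candidates w = concatMap words (upTo (suc w))

isSchroderPath : ℕ → List Step → Bool
isSchroderPath n p = ⌊ width p ≟ (n + n) ⌋ ∧ validFrom 0 p

littleSchroder : ℕ → ℕ
littleSchroder n = length (filterᵇ (isSchroderPath n) (candidates (n + n)))

module Submission where

-- Read a matching from left to right, keeping the currently open points on a stack.  An opener
-- is an up step and a closer a down step.  A 2-distant crossing joins arcs (i₁ , j₁), (i₂ , j₂)
-- with i₁ < i₂ < j₁ < j₂ and j₁ - i₂ ≥ 2, so in a 2-distant noncrossing matching every closer
-- closes the point on top of the stack, except that an opener i₂ may be immediately followed
-- by the closer j₁ = i₂ + 1 of the point below it on the stack.  Reading such a pair as one flat
-- step, the matching becomes a Schröder path whose height is the size of the stack; a flat step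
-- needs a point below, hence never lies on the x-axis.  Conversely every such path is read off
-- exactly one matching, and the two counts agree.

open import Data.Bool using (Bool; true; false; T; not; _∧_; if_then_else_)
open import Data.Bool.Properties using (T?; T-∧)
open import Data.Empty using (⊥-elim)
open import Data.Fin using (Fin; toℕ; fromℕ<)
open import Data.Fin.Properties using (toℕ-injective; toℕ<n; toℕ-fromℕ<) renaming (_≟_ to _≟ᶠ_)
open import Data.List
  using (List; []; _∷_; map; concatMap; length; filterᵇ; upTo; allFin; cartesianProductWith; _++_)
open import Data.List.Properties using (length-map) renaming (∷-injective to ∷ˡ-injective)
open import Data.List.Membership.Propositional using (_∈_; lose)
open import Data.List.Membership.Propositional.Properties
open import Data.List.Membership.Propositional.Properties.WithK using (unique∧set⇒bag)
open import Data.List.Relation.Binary.BagAndSetEquality using (∼bag⇒↭)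
open import Data.List.Relation.Binary.Disjoint.Propositional using (Disjoint)
open import Data.List.Relation.Binary.Permutation.Propositional.Properties using (↭-length)
open import Data.List.Relation.Unary.All using (All; []; _∷_)
import Data.List.Relation.Unary.All as All
import Data.List.Relation.Unary.All.Properties as All
open import Data.List.Relation.Unary.All.Properties using (all⁺; all⁻; all-filter)
open import Data.List.Relation.Unary.AllPairs using ([]; _∷_)
import Data.List.Relation.Unary.AllPairs as AllPairs
import Data.List.Relation.Unary.AllPairs.Properties as AllPairs
open import Data.List.Relation.Unary.Any using (here; there; satisfied)
open import Data.List.Relation.Unary.Any.Properties using (any⁺; any⁻)
open import Data.List.Relation.Unary.Unique.Propositional using (Unique)
import Data.List.Relation.Unary.Unique.Propositional.Properties as Unique
open import Data.Nat using (ℕ; zero; suc; _+_; _∸_; _≤_; _<_; z≤n; s≤s; _≟_; _<?_; _≤?_)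
open import Data.Nat.Properties
open import Data.Product using (_×_; _,_; proj₁; proj₂; ∃-syntax)
open import Data.Sum using (_⊎_; inj₁; inj₂)
open import Data.Unit using (tt)
open import Data.Vec using (Vec; lookup; tabulate) renaming ([] to []ᵛ; _∷_ to _∷ᵛ_)
open import Data.Vec.Properties using (∷-injective; lookup∘tabulate; tabulate∘lookup; tabulate-cong)
open import Function using (_∘_; case_of_)
open import Function.Bundles using (mk⇔; _⇔_; Equivalence)
open import Relation.Binary.PropositionalEquality
open import Relation.Nullary using (¬_; Dec; yes; no)
open import Relation.Nullary.Decidable
  using (⌊_⌋; toWitness; fromWitness; toWitnessFalse; fromWitnessFalse)
open ≡-Reasoning

open import Defs

module _ {A B : Set} (p : A → Bool) (q : B → Bool) (f : A → B)
         (f-injective : ∀ a a′ → T (p a) → T (p a′) → f a ≡ f a′ → a ≡ a′) where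

  private
    map⁺-Unique : ∀ {xs} → Unique xs → All (T ∘ p) xs → Unique (map f xs)
    map⁺-Unique {[]}     []          []          = []
    map⁺-Unique {x ∷ xs} (x∉xs ∷ xs!) (px ∷ pxs) =
      All.map⁺ (All.zipWith (λ (x≢y , py) fx≡fy → x≢y (f-injective _ _ px py fx≡fy)) (x∉xs , pxs))
      ∷ map⁺-Unique xs! pxs

  length-filterᵇ-bijection :
    ∀ {xs ys} → Unique xs → Unique ys → (∀ a → a ∈ xs) → (∀ b → T (q b) → b ∈ ys) →
    (∀ a → T (p a) → T (q (f a))) → (∀ b → T (q b) → ∃[ a ] T (p a) × f a ≡ b) →
    length (filterᵇ p xs) ≡ length (filterᵇ q ys)
  length-filterᵇ-bijection {xs} {ys} xs! ys! ∈xs ∈ys pq onto =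
    trans (sym (length-map f (filterᵇ p xs)))
      (↭-length (∼bag⇒↭ (unique∧set⇒bag image! (Unique.filter⁺ (T? ∘ q) ys!) (mk⇔ to from))))
    where
    image! : Unique (map f (filterᵇ p xs))
    image! = map⁺-Unique (Unique.filter⁺ (T? ∘ p) xs!) (all-filter (T? ∘ p) xs)

    to : ∀ {b} → b ∈ map f (filterᵇ p xs) → b ∈ filterᵇ q ys
    to b∈ with ∈-map⁻ f b∈
    ... | a , a∈ , refl = ∈-filter⁺ (T? ∘ q) (∈ys _ qfa) qfa
      where qfa = pq a (proj₂ (∈-filter⁻ (T? ∘ p) {xs = xs} a∈))

    from : ∀ {b} → b ∈ filterᵇ q ys → b ∈ map f (filterᵇ p xs)
    from {b} b∈ with onto b (proj₂ (∈-filter⁻ (T? ∘ q) {xs = ys} b∈))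
    ... | a , pa , refl = ∈-map⁺ f (∈-filter⁺ (T? ∘ p) (∈xs a) pa)

module _ {A : Set} (a? : Dec A) {y : Bool} where

  True-∧⁻ : T (⌊ a? ⌋ ∧ y) → A × T y
  True-∧⁻ h = let ta , ty = Equivalence.to T-∧ h in toWitness ta , ty

  True-∧⁺ : A → T y → T (⌊ a? ⌋ ∧ y)
  True-∧⁺ a ty = Equivalence.from T-∧ (fromWitness a , ty)

T-not : ∀ {x} → T (not x) ⇔ (¬ T x)
T-not {true}  = mk⇔ (λ ()) (λ ¬T → ¬T tt)
T-not {false} = mk⇔ (λ _ ()) (λ _ → tt)

concatMap-map≡cartesianProductWith :
  ∀ {A B C : Set} (f : A → B → C) xs ys →
  concatMap (λ x → map (f x) ys) xs ≡ cartesianProductWith f xs ys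
concatMap-map≡cartesianProductWith f []       ys = refl
concatMap-map≡cartesianProductWith f (x ∷ xs) ys =
  cong (map (f x) ys ++_) (concatMap-map≡cartesianProductWith f xs ys)

allVecs-suc : ∀ k m → allVecs k (suc m) ≡ cartesianProductWith _∷ᵛ_ (allFin k) (allVecs k m)
allVecs-suc k m = concatMap-map≡cartesianProductWith _∷ᵛ_ (allFin k) (allVecs k m)

allVecs-complete : ∀ k m (v : Vec (Fin k) m) → v ∈ allVecs k m
allVecs-complete k zero    []ᵛ      = here refl
allVecs-complete k (suc m) (x ∷ᵛ v) = subst (x ∷ᵛ v ∈_) (sym (allVecs-suc k m))
  (∈-cartesianProductWith⁺ _∷ᵛ_ (∈-allFin x) (allVecs-complete k m v))

allVecs-unique : ∀ k m → Unique (allVecs k m)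
allVecs-unique k zero    = [] ∷ []
allVecs-unique k (suc m) = subst Unique (sym (allVecs-suc k m))
  (Unique.cartesianProductWith⁺ _∷ᵛ_ ∷-injective (Unique.allFin⁺ k) (allVecs-unique k m))

steps : List Step
steps = U ∷ D ∷ H ∷ []

steps-unique : Unique steps
steps-unique = ((λ ()) ∷ (λ ()) ∷ []) ∷ ((λ ()) ∷ []) ∷ [] ∷ []

∈-steps : ∀ s → s ∈ steps
∈-steps U = here refl
∈-steps D = there (here refl)
∈-steps H = there (there (here refl))

words-suc : ∀ l → words (suc l) ≡ cartesianProductWith _∷_ steps (words l)
words-suc l = concatMap-map≡cartesianProductWith _∷_ steps (words l)

words-complete : ∀ w → w ∈ words (length w)
words-complete []      = here refl
words-complete (s ∷ w) = subst (s ∷ w ∈_) (sym (words-suc (length w)))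
  (∈-cartesianProductWith⁺ _∷_ (∈-steps s) (words-complete w))

words-unique : ∀ l → Unique (words l)
words-unique zero    = [] ∷ []
words-unique (suc l) = subst Unique (sym (words-suc l))
  (Unique.cartesianProductWith⁺ _∷_ ∷ˡ-injective steps-unique (words-unique l))

length-∈-words : ∀ l {w} → w ∈ words l → length w ≡ l
length-∈-words zero    (here refl) = refl
length-∈-words (suc l) w∈ with ∈-cartesianProductWith⁻ _∷_ steps (words l)
                                   (subst (_ ∈_) (words-suc l) w∈)
... | _ , u , _ , u∈ , refl = cong suc (length-∈-words l u∈)

candidates-unique : ∀ w → Unique (candidates w)
candidates-unique w = Unique.concat⁺
  (All.map⁺ (All.universal words-unique (upTo (suc w))))
  (AllPairs.map⁺ (AllPairs.map disjoint (Unique.upTo⁺ (suc w))))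
  where
  disjoint : ∀ {k l} → k ≢ l → Disjoint (words k) (words l)
  disjoint k≢l (u∈k , u∈l) = k≢l (trans (sym (length-∈-words _ u∈k)) (length-∈-words _ u∈l))

length≤width : ∀ w → length w ≤ width w
length≤width []      = z≤n
length≤width (U ∷ w) = s≤s (length≤width w)
length≤width (D ∷ w) = s≤s (length≤width w)
length≤width (H ∷ w) = s≤s (≤-trans (length≤width w) (n≤1+n _))

∈-candidates : ∀ w → w ∈ candidates (width w)
∈-candidates w = ∈-concat⁺′ (words-complete w) (∈-map⁺ words (∈-upTo⁺ (s≤s (length≤width w))))

-- σ : ℕ → ℕ stands for the partner map of a matching of the points 0, …, m - 1; its values at
-- points ≥ m are irrelevant.
module Scanning (m : ℕ) where

  data Below : ℕ → List ℕ → Set where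
    []  : ∀ {t} → Below t []
    _∷_ : ∀ {t x S} → x < t → Below x S → Below t (x ∷ S)

  Below-weaken : ∀ {t u S} → t ≤ u → Below t S → Below u S
  Below-weaken _   []        = []
  Below-weaken t≤u (x<t ∷ b) = ≤-trans x<t t≤u ∷ b

  Below-∈ : ∀ {t S i} → Below t S → i ∈ S → i < t
  Below-∈ (x<t ∷ _) (here refl) = x<t
  Below-∈ (x<t ∷ b) (there i∈S) = <-trans (Below-∈ b i∈S) x<t

  Below-head-max : ∀ {t a S i} → Below t (a ∷ S) → i ∈ a ∷ S → i ≤ a
  Below-head-max _       (here refl) = ≤-refl
  Below-head-max (_ ∷ b) (there i∈S) = <⇒≤ (Below-∈ b i∈S)

  -- Scan σ t S w: reading positions t, t + 1, … of σ, with S the points opened before t and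
  -- not yet closed (latest first), yields w.  An H step is an opener t immediately followed by
  -- the closer of the point on top of the stack; t itself then replaces that point.
  data Scan (σ : ℕ → ℕ) : ℕ → List ℕ → List Step → Set where
    end  : Scan σ m [] []
    up   : ∀ {t S w} → t < m → t < σ t → Scan σ (suc t) (t ∷ S) w → Scan σ t S (U ∷ w)
    down : ∀ {t a S w} → t < m → a < t → σ t ≡ a → σ a ≡ t →
           Scan σ (suc t) S w → Scan σ t (a ∷ S) (D ∷ w)
    flat : ∀ {t a S w} → suc t < m → a < t → suc t < σ t → σ (suc t) ≡ a → σ a ≡ suc t →
           Scan σ (suc (suc t)) (t ∷ S) w → Scan σ t (a ∷ S) (H ∷ w)

  Scan⇒width : ∀ {σ t S w} → Scan σ t S w → width w + t ≡ m
  Scan⇒width end = refl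
  Scan⇒width {t = t} {w = U ∷ w} (up _ _ r) = trans (sym (+-suc (width w) t)) (Scan⇒width r)
  Scan⇒width {t = t} {w = D ∷ w} (down _ _ _ _ r) = trans (sym (+-suc (width w) t)) (Scan⇒width r)
  Scan⇒width {t = t} {w = H ∷ w} (flat _ _ _ _ _ r) = begin
    suc (suc (width w + t))  ≡⟨ cong suc (sym (+-suc (width w) t)) ⟩
    suc (width w + suc t)    ≡⟨ sym (+-suc (width w) (suc t)) ⟩
    width w + suc (suc t)    ≡⟨ Scan⇒width r ⟩
    m                        ∎

  validFrom-U : ∀ h w → validFrom h (U ∷ w) ≡ validFrom (suc h) w
  validFrom-U zero    w = refl
  validFrom-U (suc h) w = refl

  Scan⇒validFrom : ∀ {σ t S w} → Scan σ t S w → T (validFrom (length S) w)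
  Scan⇒validFrom end = tt
  Scan⇒validFrom {S = S} {w = U ∷ w} (up _ _ r) =
    subst T (sym (validFrom-U (length S) w)) (Scan⇒validFrom r)
  Scan⇒validFrom (down _ _ _ _ r)   = Scan⇒validFrom r
  Scan⇒validFrom (flat _ _ _ _ _ r) = Scan⇒validFrom r

  stack-partner-≥ : ∀ {σ t S w a} → Scan σ t S w → a ∈ S → t ≤ σ a
  stack-partner-≥ (up _ _ r)         a∈S         = <⇒≤ (stack-partner-≥ r (there a∈S))
  stack-partner-≥ (down _ _ _ e r)   (here refl) = ≤-reflexive (sym e)
  stack-partner-≥ (down _ _ _ _ r)   (there a∈S) = <⇒≤ (stack-partner-≥ r a∈S)
  stack-partner-≥ (flat _ _ _ _ e r) (here refl) = ≤-trans (n≤1+n _) (≤-reflexive (sym e))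
  stack-partner-≥ (flat _ _ _ _ _ r) (there a∈S) =
    ≤-trans (n≤1+n _) (<⇒≤ (stack-partner-≥ r (there a∈S)))

  Scan-after-push : ∀ {σ t S w} → Scan σ (suc t) (t ∷ S) w → t ≤ σ (suc t)
  Scan-after-push (up _ lt _)         = ≤-trans (n≤1+n _) (<⇒≤ lt)
  Scan-after-push (down _ _ e _ _)    = ≤-reflexive (sym e)
  Scan-after-push (flat _ _ lt _ _ _) = ≤-trans (n≤1+n _) (≤-trans (n≤1+n _) (<⇒≤ lt))

  -- the points on which a scan from t with stack S determines σ
  Zone : ℕ → List ℕ → ℕ → Set
  Zone t S i = t ≤ i × i < m ⊎ i ∈ S

  Zone-up⁻ : ∀ {t S i} → t < m → Zone (suc t) (t ∷ S) i → Zone t S i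
  Zone-up⁻ _   (inj₁ (t<i , i<m))  = inj₁ (<⇒≤ t<i , i<m)
  Zone-up⁻ t<m (inj₂ (here refl))  = inj₁ (≤-refl , t<m)
  Zone-up⁻ _   (inj₂ (there i∈S))  = inj₂ i∈S

  Zone-down⁻ : ∀ {t a S i} → Zone (suc t) S i → Zone t (a ∷ S) i
  Zone-down⁻ (inj₁ (t<i , i<m)) = inj₁ (<⇒≤ t<i , i<m)
  Zone-down⁻ (inj₂ i∈S)         = inj₂ (there i∈S)

  Zone-flat⁻ : ∀ {t a S i} → t < m → Zone (suc (suc t)) (t ∷ S) i → Zone t (a ∷ S) i
  Zone-flat⁻ _   (inj₁ (t+1<i , i<m)) = inj₁ (≤-trans (n≤1+n _) (<⇒≤ t+1<i) , i<m)
  Zone-flat⁻ t<m (inj₂ (here refl))   = inj₁ (≤-refl , t<m)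
  Zone-flat⁻ _   (inj₂ (there i∈S))   = inj₂ (there i∈S)

  Zone-up⁺ : ∀ {t S i} → Zone t S i → Zone (suc t) (t ∷ S) i
  Zone-up⁺ {t} {i = i} (inj₁ (t≤i , i<m)) with i ≟ t
  ... | yes refl = inj₂ (here refl)
  ... | no i≢t   = inj₁ (≤∧≢⇒< t≤i (i≢t ∘ sym) , i<m)
  Zone-up⁺ (inj₂ i∈S) = inj₂ (there i∈S)

  Zone-down⁺ : ∀ {t a S i} → Zone t (a ∷ S) i → i ≢ t → i ≢ a → Zone (suc t) S i
  Zone-down⁺ (inj₁ (t≤i , i<m))  i≢t _   = inj₁ (≤∧≢⇒< t≤i (i≢t ∘ sym) , i<m)
  Zone-down⁺ (inj₂ (here i≡a))   _   i≢a = ⊥-elim (i≢a i≡a)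
  Zone-down⁺ (inj₂ (there i∈S))  _   _   = inj₂ i∈S

  Zone-flat⁺ : ∀ {t a S i} → Zone t (a ∷ S) i → i ≢ suc t → i ≢ a → Zone (suc (suc t)) (t ∷ S) i
  Zone-flat⁺ {t} {i = i} (inj₁ (t≤i , i<m)) i≢t+1 _ with i ≟ t
  ... | yes refl = inj₂ (here refl)
  ... | no i≢t   = inj₁ (≤∧≢⇒< (≤∧≢⇒< t≤i (i≢t ∘ sym)) (i≢t+1 ∘ sym) , i<m)
  Zone-flat⁺ (inj₂ (here i≡a))  _ i≢a = ⊥-elim (i≢a i≡a)
  Zone-flat⁺ (inj₂ (there i∈S)) _ _   = inj₂ (there i∈S)

  Scan-cong : ∀ {σ σ′ t S w} → (∀ {i} → Zone t S i → σ i ≡ σ′ i) → Scan σ t S w → Scan σ′ t S w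
  Scan-cong eq end = end
  Scan-cong eq (up t<m t<σt r) =
    up t<m (subst (_ <_) (eq (inj₁ (≤-refl , t<m))) t<σt) (Scan-cong (eq ∘ Zone-up⁻ t<m) r)
  Scan-cong eq (down t<m a<t σt≡a σa≡t r) =
    down t<m a<t (trans (sym (eq (inj₁ (≤-refl , t<m)))) σt≡a) (trans (sym (eq (inj₂ (here refl)))) σa≡t)
      (Scan-cong (eq ∘ Zone-down⁻) r)
  Scan-cong eq (flat t+1<m a<t t+1<σt σt+1≡a σa≡t+1 r) =
    flat t+1<m a<t (subst (_ <_) (eq (inj₁ (≤-refl , t<m))) t+1<σt)
      (trans (sym (eq (inj₁ (n≤1+n _ , t+1<m)))) σt+1≡a) (trans (sym (eq (inj₂ (here refl)))) σa≡t+1)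
      (Scan-cong (eq ∘ Zone-flat⁻ t<m) r)
    where t<m = <-trans (n<1+n _) t+1<m

  Scan-injective : ∀ {σ σ′ t S w} → Scan σ t S w → Scan σ′ t S w → ∀ {i} → Zone t S i → σ i ≡ σ′ i
  Scan-injective end end (inj₁ (m≤i , i<m)) = ⊥-elim (≤⇒≯ m≤i i<m)
  Scan-injective (up _ _ r) (up _ _ r′) z = Scan-injective r r′ (Zone-up⁺ z)
  Scan-injective {t = t} (down {a = a} _ _ σt≡a σa≡t r) (down _ _ σ′t≡a σ′a≡t r′) {i} z
    with i ≟ t | i ≟ a
  ... | yes refl | _        = trans σt≡a (sym σ′t≡a)
  ... | no _     | yes refl = trans σa≡t (sym σ′a≡t)
  ... | no i≢t   | no i≢a   = Scan-injective r r′ (Zone-down⁺ z i≢t i≢a)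
  Scan-injective {t = t} (flat {a = a} _ _ _ σt+1≡a σa≡t+1 r) (flat _ _ _ σ′t+1≡a σ′a≡t+1 r′) {i} z
    with i ≟ suc t | i ≟ a
  ... | yes refl | _        = trans σt+1≡a (sym σ′t+1≡a)
  ... | no _     | yes refl = trans σa≡t+1 (sym σ′a≡t+1)
  ... | no i≢t+1 | no i≢a   = Scan-injective r r′ (Zone-flat⁺ z i≢t+1 i≢a)

  Matched : (ℕ → ℕ) → ℕ → Set
  Matched σ i = σ i < m × σ i ≢ i × σ (σ i) ≡ i

  matched-pair : ∀ {σ i j} → j < m → j ≢ i → σ i ≡ j → σ j ≡ i → Matched σ i
  matched-pair {σ} j<m j≢i σi≡j σj≡i =
    subst (_< m) (sym σi≡j) j<m , (λ σi≡i → j≢i (trans (sym σi≡j) σi≡i)) , trans (cong σ σi≡j) σj≡i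

  Scan⇒Matched : ∀ {σ t S w} → Scan σ t S w → ∀ {i} → Zone t S i → Matched σ i
  Scan⇒Matched end (inj₁ (m≤i , i<m)) = ⊥-elim (≤⇒≯ m≤i i<m)
  Scan⇒Matched (up _ _ r) z = Scan⇒Matched r (Zone-up⁺ z)
  Scan⇒Matched {t = t} (down {a = a} t<m a<t σt≡a σa≡t r) {i} z with i ≟ t | i ≟ a
  ... | yes refl | _        = matched-pair (<-trans a<t t<m) (<⇒≢ a<t) σt≡a σa≡t
  ... | no _     | yes refl = matched-pair t<m (<⇒≢ a<t ∘ sym) σa≡t σt≡a
  ... | no i≢t   | no i≢a   = Scan⇒Matched r (Zone-down⁺ z i≢t i≢a)
  Scan⇒Matched {σ} {t = t} (flat {a = a} t+1<m a<t _ σt+1≡a σa≡t+1 r) {i} z with i ≟ suc t | i ≟ a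
  ... | yes refl | _        = matched-pair {σ} (<-trans a<t+1 t+1<m) (<⇒≢ a<t+1) σt+1≡a σa≡t+1
    where a<t+1 = <-trans a<t (n<1+n t)
  ... | no _     | yes refl = matched-pair {σ} t+1<m (<⇒≢ a<t+1 ∘ sym) σa≡t+1 σt+1≡a
    where a<t+1 = <-trans a<t (n<1+n t)
  ... | no i≢t+1 | no i≢a   = Scan⇒Matched r (Zone-flat⁺ z i≢t+1 i≢a)

  Involutive : (ℕ → ℕ) → Set
  Involutive σ = ∀ {i} → i < m → σ (σ i) ≡ i

  record IsMatching (σ : ℕ → ℕ) : Set where
    field
      bounded       : ∀ {i} → i < m → σ i < m
      fixpoint-free : ∀ {i} → i < m → σ i ≢ i
      involutive    : Involutive σ

  Scan⇒IsMatching : ∀ {σ w} → Scan σ 0 [] w → IsMatching σ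
  Scan⇒IsMatching r = record
    { bounded       = λ i<m → proj₁ (matched i<m)
    ; fixpoint-free = λ i<m → proj₁ (proj₂ (matched i<m))
    ; involutive    = λ i<m → proj₂ (proj₂ (matched i<m))
    }
    where matched = λ {i} (i<m : i < m) → Scan⇒Matched r (inj₁ (z≤n , i<m))

  -- a crossing a < b < c < σ b of the arcs (a , c) and (b , σ b) is 2-distant unless c = b + 1
  Noncrossing₂ : (ℕ → ℕ) → Set
  Noncrossing₂ σ = ∀ {a b c} → σ a ≡ c → c < m → a < b → b < c → c < σ b → c ≤ suc b

  record OpenStack (σ : ℕ → ℕ) (t : ℕ) (S : List ℕ) : Set where
    field
      descending : Below t S
      complete   : ∀ {i} → i < t → t ≤ σ i → i ∈ S
      sound      : ∀ {i} → i ∈ S → t ≤ σ i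

  OpenStack-[] : ∀ {σ} → OpenStack σ 0 []
  OpenStack-[] = record { descending = [] ; complete = λ () ; sound = λ () }

  OpenStack-top-max : ∀ {σ t a S i} → OpenStack σ t (a ∷ S) → i < t → t ≤ σ i → i ≤ a
  OpenStack-top-max os i<t t≤σi = Below-head-max descending (complete i<t t≤σi)
    where open OpenStack os

  module Involution {σ : ℕ → ℕ} (involutive : Involutive σ) where

    partner-sym : ∀ {i j} → i < m → σ i ≡ j → σ j ≡ i
    partner-sym i<m σi≡j = trans (cong σ (sym σi≡j)) (involutive i<m)

    OpenStack-up : ∀ {t S} → t < m → t < σ t → OpenStack σ t S → OpenStack σ (suc t) (t ∷ S)
    OpenStack-up {t} {S} t<m t<σt os =
      record { descending = ≤-refl ∷ descending ; complete = complete′ ; sound = sound′ }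
      where
      open OpenStack os
      complete′ : ∀ {i} → i < suc t → suc t ≤ σ i → i ∈ t ∷ S
      complete′ {i} i≤t t<σi with i ≟ t
      ... | yes refl = here refl
      ... | no i≢t   = there (complete (≤∧≢⇒< (≤-pred i≤t) i≢t) (<⇒≤ t<σi))
      sound′ : ∀ {i} → i ∈ t ∷ S → suc t ≤ σ i
      sound′ (here refl) = t<σt
      sound′ (there i∈S) = ≤∧≢⇒< (sound i∈S) λ t≡σi →
        <-asym i<t (subst (t <_) (partner-sym (<-trans i<t t<m) (sym t≡σi)) t<σt)
        where i<t = Below-∈ descending i∈S

    OpenStack-down : ∀ {t a S} → t < m → σ t ≡ a → OpenStack σ t (a ∷ S) → OpenStack σ (suc t) S
    OpenStack-down {t} {a} {S} t<m σt≡a os@record { descending = a<t ∷ b } =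
      record { descending = Below-weaken (≤-trans (<⇒≤ a<t) (n≤1+n t)) b
             ; complete = complete′ ; sound = sound′ }
      where
      open OpenStack os
      complete′ : ∀ {i} → i < suc t → suc t ≤ σ i → i ∈ S
      complete′ {i} i≤t t<σi with i ≟ t
      ... | yes refl = ⊥-elim (<-asym a<t (subst (t <_) σt≡a t<σi))
      ... | no i≢t with complete (≤∧≢⇒< (≤-pred i≤t) i≢t) (<⇒≤ t<σi)
      ...   | here refl  = ⊥-elim (<-irrefl (sym (partner-sym t<m σt≡a)) t<σi)
      ...   | there i∈S  = i∈S
      sound′ : ∀ {i} → i ∈ S → suc t ≤ σ i
      sound′ i∈S = ≤∧≢⇒< (sound (there i∈S)) λ t≡σi →
        <-irrefl (trans (sym (partner-sym (<-trans i<a (<-trans a<t t<m)) (sym t≡σi))) σt≡a) i<a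
        where i<a = Below-∈ b i∈S

    OpenStack-flat : ∀ {t a S} → suc t < m → suc t < σ t → σ (suc t) ≡ a →
                     OpenStack σ t (a ∷ S) → OpenStack σ (suc (suc t)) (t ∷ S)
    OpenStack-flat {t} {a} {S} t+1<m t+1<σt σt+1≡a os@record { descending = a<t ∷ b } =
      record { descending = ≤-trans (n<1+n t) (n≤1+n (suc t)) ∷ Below-weaken (<⇒≤ a<t) b
             ; complete = complete′ ; sound = sound′ }
      where
      open OpenStack os
      t<m = <-trans (n<1+n t) t+1<m
      complete′ : ∀ {i} → i < suc (suc t) → suc (suc t) ≤ σ i → i ∈ t ∷ S
      complete′ {i} i≤t+1 t+1<σi with i ≟ suc t | i ≟ t
      ... | yes refl | _ = ⊥-elim (<-asym a<t (≤-trans (n≤1+n _) (subst (suc (suc t) ≤_) σt+1≡a t+1<σi)))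
      ... | no _ | yes refl = here refl
      ... | no i≢t+1 | no i≢t
            with complete (≤∧≢⇒< (≤-pred (≤∧≢⇒< (≤-pred i≤t+1) i≢t+1)) i≢t)
                          (≤-trans (n≤1+n t) (≤-trans (n≤1+n (suc t)) t+1<σi))
      ...   | here refl = ⊥-elim (<-irrefl (sym (partner-sym t+1<m σt+1≡a)) t+1<σi)
      ...   | there i∈S = there i∈S
      sound′ : ∀ {i} → i ∈ t ∷ S → suc (suc t) ≤ σ i
      sound′ (here refl) = t+1<σt
      sound′ (there i∈S) = ≤∧≢⇒< (≤∧≢⇒< (sound (there i∈S)) σi≢t) σi≢t+1
        where
        i<a = Below-∈ b i∈S
        i<m = <-trans i<a (<-trans a<t t<m)
        σi≢t : t ≢ σ _
        σi≢t t≡σi = <-asym (<-trans i<a a<t)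
          (<-trans (n<1+n t) (subst (suc t <_) (partner-sym i<m (sym t≡σi)) t+1<σt))
        σi≢t+1 : suc t ≢ σ _
        σi≢t+1 t+1≡σi = <-irrefl (trans (sym (partner-sym i<m (sym t+1≡σi))) σt+1≡a) i<a

    -- When the scan reaches c, which closes a while b is still open, c closes the top a of the
    -- stack; every stack point is ≤ a < b, so b is the opener t of a flat step (t , c).
    Scan-crossing-adjacent : ∀ {t S w} → Scan σ t S w → OpenStack σ t S →
      ∀ {a b c} → t ≤ c → σ a ≡ c → c < m → a < b → b < c → c < σ b → c ≤ suc b
    Scan-crossing-adjacent end _ m≤c _ c<m = ⊥-elim (≤⇒≯ m≤c c<m)
    Scan-crossing-adjacent {t} (up t<m t<σt r) os {a} {b} {c} t≤c σa≡c c<m a<b b<c c<σb with c ≟ t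
    ... | yes refl = ⊥-elim (<-asym (<-trans a<b b<c)
                       (subst (c <_) (partner-sym (<-trans a<b (<-trans b<c c<m)) σa≡c) t<σt))
    ... | no c≢t = Scan-crossing-adjacent r (OpenStack-up t<m t<σt os)
                     (≤∧≢⇒< t≤c (c≢t ∘ sym)) σa≡c c<m a<b b<c c<σb
    Scan-crossing-adjacent {t} (down t<m _ σt≡a′ _ r) os {a} {b} {c} t≤c σa≡c c<m a<b b<c c<σb
      with c ≟ t
    ... | yes refl = ⊥-elim (<⇒≱ a<b (subst (b ≤_) a′≡a (OpenStack-top-max os b<c (<⇒≤ c<σb))))
      where a′≡a = trans (sym σt≡a′) (partner-sym (<-trans a<b (<-trans b<c c<m)) σa≡c)
    ... | no c≢t = Scan-crossing-adjacent r (OpenStack-down t<m σt≡a′ os)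
                     (≤∧≢⇒< t≤c (c≢t ∘ sym)) σa≡c c<m a<b b<c c<σb
    Scan-crossing-adjacent {t} (flat t+1<m _ t+1<σt σt+1≡a′ _ r) os {a} {b} {c} t≤c σa≡c c<m a<b b<c c<σb
      with c ≟ t | c ≟ suc t | b ≟ t
    ... | yes refl | _ | _ = ⊥-elim (<-asym (<-trans a<b b<c)
                               (subst (c <_) (partner-sym a<m σa≡c) (<-trans (n<1+n c) t+1<σt)))
      where a<m = <-trans a<b (<-trans b<c c<m)
    ... | no _ | yes refl | yes refl = ≤-refl
    ... | no _ | yes refl | no b≢t = ⊥-elim (<⇒≱ a<b (subst (b ≤_) a′≡a
              (OpenStack-top-max os (≤∧≢⇒< (≤-pred b<c) b≢t) (≤-trans (n≤1+n t) (<⇒≤ c<σb)))))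
      where a′≡a = trans (sym σt+1≡a′) (partner-sym (<-trans a<b (<-trans b<c c<m)) σa≡c)
    ... | no c≢t | no c≢t+1 | _ = Scan-crossing-adjacent r (OpenStack-flat t+1<m t+1<σt σt+1≡a′ os)
          (≤∧≢⇒< (≤∧≢⇒< t≤c (c≢t ∘ sym)) (c≢t+1 ∘ sym)) σa≡c c<m a<b b<c c<σb

  Scan⇒Noncrossing₂ : ∀ {σ w} → Scan σ 0 [] w → Noncrossing₂ σ
  Scan⇒Noncrossing₂ r =
    Involution.Scan-crossing-adjacent (IsMatching.involutive (Scan⇒IsMatching r)) r OpenStack-[] z≤n

  encode : (ℕ → ℕ) → ℕ → ℕ → List Step
  encode σ t zero          = []
  encode σ t (suc zero)    = if ⌊ t <? σ t ⌋ then U ∷ [] else D ∷ []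
  encode σ t (suc (suc r)) =
    if ⌊ t <? σ t ⌋
      then (if ⌊ σ (suc t) <? t ⌋ then H ∷ encode σ (suc (suc t)) r else U ∷ encode σ (suc t) (suc r))
      else D ∷ encode σ (suc t) (suc r)

  module _ {σ : ℕ → ℕ} {t : ℕ} where

    encode-up : ∀ r → t < σ t → ¬ σ (suc t) < t → encode σ t (suc r) ≡ U ∷ encode σ (suc t) r
    encode-up zero t<σt _ with t <? σ t
    ... | yes _    = refl
    ... | no t≮σt = ⊥-elim (t≮σt t<σt)
    encode-up (suc r) t<σt σt+1≮t with t <? σ t | σ (suc t) <? t
    ... | yes _    | no _         = refl
    ... | yes _    | yes σt+1<t = ⊥-elim (σt+1≮t σt+1<t)
    ... | no t≮σt | _            = ⊥-elim (t≮σt t<σt)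

    encode-down : ∀ r → ¬ t < σ t → encode σ t (suc r) ≡ D ∷ encode σ (suc t) r
    encode-down zero t≮σt with t <? σ t
    ... | yes t<σt = ⊥-elim (t≮σt t<σt)
    ... | no _      = refl
    encode-down (suc r) t≮σt with t <? σ t
    ... | yes t<σt = ⊥-elim (t≮σt t<σt)
    ... | no _      = refl

    encode-flat : ∀ r → t < σ t → σ (suc t) < t → encode σ t (suc (suc r)) ≡ H ∷ encode σ (suc (suc t)) r
    encode-flat r t<σt σt+1<t with t <? σ t | σ (suc t) <? t
    ... | yes _    | yes _         = refl
    ... | yes _    | no σt+1≮t   = ⊥-elim (σt+1≮t σt+1<t)
    ... | no t≮σt | _            = ⊥-elim (t≮σt t<σt)

  Scan⇒encode : ∀ {σ t S w} → Scan σ t S w → encode σ t (width w) ≡ w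
  Scan⇒encode end = refl
  Scan⇒encode {w = U ∷ w} (up _ t<σt r) =
    trans (encode-up (width w) t<σt (≤⇒≯ (Scan-after-push r))) (cong (U ∷_) (Scan⇒encode r))
  Scan⇒encode {w = D ∷ w} (down _ a<t σt≡a _ r) =
    trans (encode-down (width w) (<-asym (subst (_< _) (sym σt≡a) a<t))) (cong (D ∷_) (Scan⇒encode r))
  Scan⇒encode {w = H ∷ w} (flat _ a<t t+1<σt σt+1≡a _ r) =
    trans (encode-flat (width w) (<-trans (n<1+n _) t+1<σt) (subst (_< _) (sym σt+1≡a) a<t))
      (cong (H ∷_) (Scan⇒encode r))

  suc+≡⇒< : ∀ k {t} → suc k + t ≡ m → t < m
  suc+≡⇒< k {t} e = subst (t <_) e (s≤s (m≤n+m t k))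

  module Encoding {σ : ℕ → ℕ} (matching : IsMatching σ) (noncrossing : Noncrossing₂ σ) where
    open IsMatching matching
    open Involution {σ} involutive

    -- t is not the second position of a pair that must be read as a single H step
    NotInsideFlat : ℕ → Set
    NotInsideFlat t = ∀ {x} → suc x ≡ t → t < m → t < σ x → x ≤ σ t

    Continuation : ℕ → List Step → Set
    Continuation t w = ∀ {S} → OpenStack σ t S → NotInsideFlat t → Scan σ t S w

    Scan-up : ∀ {t S w} → t < m → t < σ t → (suc t < m → t ≤ σ (suc t)) →
              OpenStack σ t S → Continuation (suc t) w → Scan σ t S (U ∷ w)
    Scan-up t<m t<σt next os k =
      up t<m t<σt (k (OpenStack-up t<m t<σt os) λ { refl t+1<m _ → next t+1<m })

    -- σ t is open at t.  Were it below the top x of the stack, the arcs (σ t , t) and (x , σ x)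
    -- would cross, so x + 1 = t by noncrossing, and x , t should have been read as one H step.
    Scan-down : ∀ {t S w} → t < m → ¬ t < σ t → OpenStack σ t S → NotInsideFlat t →
                Continuation (suc t) w → Scan σ t S (D ∷ w)
    Scan-down {t} {w = w} t<m t≮σt os notInside k =
      go os (OpenStack.complete os σt<t (≤-reflexive (sym (involutive t<m))))
      where
      σt<t = ≤∧≢⇒< (≮⇒≥ t≮σt) (fixpoint-free t<m)
      go : ∀ {S} → OpenStack σ t S → σ t ∈ S → Scan σ t S (D ∷ w)
      go os@record { descending = σt<t ∷ _ } (here refl) =
        down t<m σt<t refl (involutive t<m)
          (k (OpenStack-down t<m refl os)
             λ { refl _ t+1<σt → ⊥-elim (t≮σt (<-trans (n<1+n t) t+1<σt)) })
      go os@record { descending = x<t ∷ b } (there σt∈S) =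
        ⊥-elim (<⇒≱ σt<x (notInside x+1≡t t<m t<σx))
        where
        open OpenStack os
        σt<x = Below-∈ b σt∈S
        t<σx : t < σ _
        t<σx = ≤∧≢⇒< (sound (here refl)) λ t≡σx →
          <-irrefl (partner-sym (<-trans x<t t<m) (sym t≡σx)) σt<x
        x+1≡t = ≤-antisym x<t (noncrossing (involutive t<m) t<m σt<x x<t t<σx)

    -- σ (t + 1) is open at t.  Were it below the top x of the stack, the arcs (σ (t + 1) , t + 1)
    -- and (x , σ x) would cross at distance t + 1 - x ≥ 2.
    Scan-flat : ∀ {t S w} → suc t < m → t < σ t → σ (suc t) < t →
                OpenStack σ t S → Continuation (suc (suc t)) w → Scan σ t S (H ∷ w)
    Scan-flat {t} {w = w} t+1<m t<σt σt+1<t os k =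
      go os (OpenStack.complete os σt+1<t (≤-trans (n≤1+n t) (≤-reflexive (sym (involutive t+1<m)))))
      where
      t<m = <-trans (n<1+n t) t+1<m
      t+1<σt : suc t < σ t
      t+1<σt = ≤∧≢⇒< t<σt λ t+1≡σt → <-irrefl (partner-sym t<m (sym t+1≡σt)) σt+1<t
      go : ∀ {S} → OpenStack σ t S → σ (suc t) ∈ S → Scan σ t S (H ∷ w)
      go os@record { descending = a<t ∷ _ } (here refl) =
        flat t+1<m a<t t+1<σt refl (involutive t+1<m)
          (k (OpenStack-flat t+1<m t+1<σt refl os)
             λ { refl _ t+2<σt+1 →
                   ⊥-elim (<-asym σt+1<t (<-trans (n<1+n t) (<-trans (n<1+n _) t+2<σt+1))) })
      go os@record { descending = x<t ∷ b } (there a∈S) =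
        ⊥-elim (<⇒≱ x<t (≤-pred
          (noncrossing (involutive t+1<m) t+1<m a<x (<-trans x<t (n<1+n t)) t+1<σx)))
        where
        open OpenStack os
        a<x = Below-∈ b a∈S
        x<m = <-trans x<t t<m
        t+1<σx : suc t < σ _
        t+1<σx = ≤∧≢⇒< (≤∧≢⇒< (sound (here refl))
          (λ t≡σx → <-asym x<t (subst (t <_) (partner-sym x<m (sym t≡σx)) t<σt)))
          (λ t+1≡σx → <-irrefl (partner-sym x<m (sym t+1≡σx)) a<x)

    encode-Scan₁ : ∀ {t S} → suc t ≡ m → OpenStack σ t S → NotInsideFlat t →
                   Continuation (suc t) [] → Scan σ t S (encode σ t 1)
    encode-Scan₁ {t} e os notInside k with t <? σ t
    ... | yes t<σt = Scan-up (suc+≡⇒< 0 e) t<σt (λ t+1<m → ⊥-elim (<-irrefl e t+1<m)) os k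
    ... | no t≮σt  = Scan-down (suc+≡⇒< 0 e) t≮σt os notInside k

    encode-Scan₂ : ∀ r {t S} → suc (suc r) + t ≡ m → OpenStack σ t S → NotInsideFlat t →
                   Continuation (suc t) (encode σ (suc t) (suc r)) →
                   Continuation (suc (suc t)) (encode σ (suc (suc t)) r) →
                   Scan σ t S (encode σ t (suc (suc r)))
    encode-Scan₂ r {t} e os notInside k₁ k₂ with t <? σ t | σ (suc t) <? t
    ... | no t≮σt  | _          = Scan-down (suc+≡⇒< (suc r) e) t≮σt os notInside k₁
    ... | yes t<σt | yes σt+1<t = Scan-flat (suc+≡⇒< r (trans (+-suc (suc r) t) e)) t<σt σt+1<t os k₂
    ... | yes t<σt | no σt+1≮t  = Scan-up (suc+≡⇒< (suc r) e) t<σt (λ _ → ≮⇒≥ σt+1≮t) os k₁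

    encode-Scan : ∀ r {t S} → r + t ≡ m → OpenStack σ t S → NotInsideFlat t → Scan σ t S (encode σ t r)
    encode-Scan zero {S = []}    refl _  _ = end
    encode-Scan zero {S = _ ∷ _} refl os _ =
      ⊥-elim (≤⇒≯ (sound (here refl)) (bounded (Below-∈ descending (here refl))))
      where open OpenStack os
    encode-Scan (suc zero) e os notInside = encode-Scan₁ e os notInside (encode-Scan 0 e)
    encode-Scan (suc (suc r)) {t} e os notInside =
      encode-Scan₂ r e os notInside (encode-Scan (suc r) e₁) (encode-Scan r (trans (+-suc r (suc t)) e₁))
      where e₁ = trans (+-suc (suc r) t) e

  encode-Scan : ∀ {σ} → IsMatching σ → Noncrossing₂ σ → Scan σ 0 [] (encode σ 0 m)
  encode-Scan matching noncrossing =
    Encoding.encode-Scan matching noncrossing m (+-identityʳ m) OpenStack-[] λ ()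

  swap : (ℕ → ℕ) → ℕ → ℕ → ℕ → ℕ
  swap σ x y i with i ≟ x | i ≟ y
  ... | yes _ | _     = y
  ... | no _  | yes _ = x
  ... | no _  | no _  = σ i

  swap-x : ∀ σ x y → swap σ x y x ≡ y
  swap-x σ x y with x ≟ x | x ≟ y
  ... | yes _   | _ = refl
  ... | no x≢x | _ = ⊥-elim (x≢x refl)

  swap-y : ∀ σ x y → x ≢ y → swap σ x y y ≡ x
  swap-y σ x y x≢y with y ≟ x | y ≟ y
  ... | yes y≡x | _        = ⊥-elim (x≢y (sym y≡x))
  ... | no _    | yes _    = refl
  ... | no _    | no y≢y  = ⊥-elim (y≢y refl)

  swap-other : ∀ σ x y {i} → i ≢ x → i ≢ y → swap σ x y i ≡ σ i
  swap-other σ x y {i} i≢x i≢y with i ≟ x | i ≟ y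
  ... | yes i≡x | _        = ⊥-elim (i≢x i≡x)
  ... | no _    | yes i≡y = ⊥-elim (i≢y i≡y)
  ... | no _    | no _     = refl

  down-swap : ∀ {σ t a S w} → t < m → a < t → Below a S →
              Scan σ (suc t) S w → Scan (swap σ t a) t (a ∷ S) (D ∷ w)
  down-swap {σ} {t} {a} {S} t<m a<t b r =
    down t<m a<t (swap-x σ t a) (swap-y σ t a (<⇒≢ a<t ∘ sym))
      (Scan-cong (λ z → sym (swap-other σ t a (t-fresh z ∘ sym) (a-fresh z ∘ sym))) r)
    where
    t-fresh : ∀ {i} → Zone (suc t) S i → t ≢ i
    t-fresh (inj₁ (t<i , _)) = <⇒≢ t<i
    t-fresh (inj₂ i∈S)       = <⇒≢ (<-trans (Below-∈ b i∈S) a<t) ∘ sym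
    a-fresh : ∀ {i} → Zone (suc t) S i → a ≢ i
    a-fresh (inj₁ (t<i , _)) = <⇒≢ (<-trans a<t t<i)
    a-fresh (inj₂ i∈S)       = <⇒≢ (Below-∈ b i∈S) ∘ sym

  flat-swap : ∀ {σ t a S w} → suc t < m → a < t → Below a S →
              Scan σ (suc (suc t)) (t ∷ S) w → Scan (swap σ (suc t) a) t (a ∷ S) (H ∷ w)
  flat-swap {σ} {t} {a} {S} t+1<m a<t b r =
    flat t+1<m a<t t+1<σ′t (swap-x σ (suc t) a) (swap-y σ (suc t) a (<⇒≢ a<t+1 ∘ sym))
      (Scan-cong (λ z → sym (swap-other σ (suc t) a (t+1-fresh z ∘ sym) (a-fresh z ∘ sym))) r)
    where
    a<t+1 = <-trans a<t (n<1+n t)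
    t+1<σ′t : suc t < swap σ (suc t) a t
    t+1<σ′t = subst (suc t <_) (sym (swap-other σ (suc t) a (<⇒≢ (n<1+n t)) (<⇒≢ a<t ∘ sym)))
                (stack-partner-≥ r (here refl))
    t+1-fresh : ∀ {i} → Zone (suc (suc t)) (t ∷ S) i → suc t ≢ i
    t+1-fresh (inj₁ (t+1<i , _)) = <⇒≢ t+1<i
    t+1-fresh (inj₂ (here refl)) = <⇒≢ (n<1+n t) ∘ sym
    t+1-fresh (inj₂ (there i∈S)) = <⇒≢ (<-trans (Below-∈ b i∈S) a<t+1) ∘ sym
    a-fresh : ∀ {i} → Zone (suc (suc t)) (t ∷ S) i → a ≢ i
    a-fresh (inj₁ (t+1<i , _)) = <⇒≢ (<-trans a<t+1 t+1<i)
    a-fresh (inj₂ (here refl)) = <⇒≢ a<t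
    a-fresh (inj₂ (there i∈S)) = <⇒≢ (Below-∈ b i∈S) ∘ sym

  Scan-exists : ∀ w {t S} → T (validFrom (length S) w) → Below t S → width w + t ≡ m →
                ∃[ σ ] Scan σ t S w
  Scan-exists [] {S = []} _ _ refl = (λ _ → 0) , end
  Scan-exists (U ∷ w) {t} {S} valid b e
    with Scan-exists w (subst T (validFrom-U (length S) w) valid) (≤-refl ∷ b)
                     (trans (+-suc (width w) t) e)
  ... | σ , r = σ , up (suc+≡⇒< (width w) e) (stack-partner-≥ r (here refl)) r
  Scan-exists (D ∷ w) {t} {a ∷ S} valid (a<t ∷ b) e
    with Scan-exists w valid (Below-weaken (≤-trans (<⇒≤ a<t) (n≤1+n t)) b) (trans (+-suc (width w) t) e)
  ... | σ , r = swap σ t a , down-swap (suc+≡⇒< (width w) e) a<t b r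
  Scan-exists (H ∷ w) {t} {a ∷ S} valid (a<t ∷ b) e
    with Scan-exists w valid (≤-trans (n<1+n t) (n≤1+n (suc t)) ∷ Below-weaken (<⇒≤ a<t) b)
           (trans (+-suc (width w) (suc t)) (trans (cong suc (+-suc (width w) t)) e))
  ... | σ , r =
    swap σ (suc t) a , flat-swap (suc+≡⇒< (width w) (trans (+-suc (suc (width w)) t) e)) a<t b r

DistantCrossing : ℕ → ℕ → ℕ → ℕ → ℕ → Set
DistantCrossing k i₁ j₁ i₂ j₂ = i₁ < j₁ × i₂ < j₂ × i₁ < i₂ × i₂ ≤ j₁ × j₁ < j₂ × k ≤ j₁ ∸ i₂

kDistantCrossingAt⁻ : ∀ {m} k (v : Vec (Fin m) m) a b → T (kDistantCrossingAt k v a b) →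
                      DistantCrossing k (toℕ a) (toℕ (lookup v a)) (toℕ b) (toℕ (lookup v b))
kDistantCrossingAt⁻ k v a b h₁ =
  let c₁ , h₂ = True-∧⁻ (i₁ <? j₁) h₁ ; c₂ , h₃ = True-∧⁻ (i₂ <? j₂) h₂
      c₃ , h₄ = True-∧⁻ (i₁ <? i₂) h₃ ; c₄ , h₅ = True-∧⁻ (i₂ ≤? j₁) h₄
      c₅ , h₆ = True-∧⁻ (j₁ <? j₂) h₅
  in c₁ , c₂ , c₃ , c₄ , c₅ , toWitness h₆
  where i₁ = toℕ a ; j₁ = toℕ (lookup v a) ; i₂ = toℕ b ; j₂ = toℕ (lookup v b)

kDistantCrossingAt⁺ : ∀ {m} k (v : Vec (Fin m) m) a b →
                      DistantCrossing k (toℕ a) (toℕ (lookup v a)) (toℕ b) (toℕ (lookup v b)) →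
                      T (kDistantCrossingAt k v a b)
kDistantCrossingAt⁺ k v a b (c₁ , c₂ , c₃ , c₄ , c₅ , c₆) =
  True-∧⁺ (i₁ <? j₁) c₁ (True-∧⁺ (i₂ <? j₂) c₂ (True-∧⁺ (i₁ <? i₂) c₃
    (True-∧⁺ (i₂ ≤? j₁) c₄ (True-∧⁺ (j₁ <? j₂) c₅ (fromWitness c₆)))))
  where i₁ = toℕ a ; j₁ = toℕ (lookup v a) ; i₂ = toℕ b ; j₂ = toℕ (lookup v b)

toFun : ∀ {k l} → Vec (Fin k) l → ℕ → ℕ
toFun []ᵛ      _       = 0
toFun (x ∷ᵛ _) zero    = toℕ x
toFun (_ ∷ᵛ v) (suc i) = toFun v i

toFun-lookup : ∀ {k l} (v : Vec (Fin k) l) j → toFun v (toℕ j) ≡ toℕ (lookup v j)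
toFun-lookup (_ ∷ᵛ _) Fin.zero    = refl
toFun-lookup (_ ∷ᵛ v) (Fin.suc j) = toFun-lookup v j

module Bridge (m : ℕ) where
  open Scanning m

  toℕ-onto : ∀ {i} → i < m → ∃[ j ] toℕ j ≡ i
  toℕ-onto i<m = fromℕ< i<m , toℕ-fromℕ< i<m

  clamp : ℕ → Fin m → Fin m
  clamp x d with x <? m
  ... | yes x<m = fromℕ< x<m
  ... | no _    = d

  toℕ-clamp : ∀ {x} d → x < m → toℕ (clamp x d) ≡ x
  toℕ-clamp {x} d x<m with x <? m
  ... | yes x<m′ = toℕ-fromℕ< x<m′
  ... | no x≮m   = ⊥-elim (x≮m x<m)

  -- a point whose partner lies outside 0, …, m - 1 becomes a fixed point
  fromFun : (ℕ → ℕ) → Vec (Fin m) m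
  fromFun σ = tabulate λ j → clamp (σ (toℕ j)) j

  toFun-fromFun : ∀ σ {i} → i < m → σ i < m → toFun (fromFun σ) i ≡ σ i
  toFun-fromFun σ i<m σi<m with toℕ-onto i<m
  ... | j , refl = begin
    toFun (fromFun σ) (toℕ j)  ≡⟨ toFun-lookup (fromFun σ) j ⟩
    toℕ (lookup (fromFun σ) j) ≡⟨ cong toℕ (lookup∘tabulate _ j) ⟩
    toℕ (clamp (σ (toℕ j)) j)  ≡⟨ toℕ-clamp j σi<m ⟩
    σ (toℕ j)                  ∎

  toFun-injective : ∀ {v v′ : Vec (Fin m) m} → (∀ {i} → i < m → toFun v i ≡ toFun v′ i) → v ≡ v′
  toFun-injective {v} {v′} eq = begin
    v                    ≡⟨ tabulate∘lookup v ⟨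
    tabulate (lookup v)  ≡⟨ tabulate-cong lookup-≡ ⟩
    tabulate (lookup v′) ≡⟨ tabulate∘lookup v′ ⟩
    v′                   ∎
    where
    lookup-≡ : ∀ j → lookup v j ≡ lookup v′ j
    lookup-≡ j = toℕ-injective (begin
      toℕ (lookup v j)   ≡⟨ toFun-lookup v j ⟨
      toFun v (toℕ j)    ≡⟨ eq (toℕ<n j) ⟩
      toFun v′ (toℕ j)   ≡⟨ toFun-lookup v′ j ⟩
      toℕ (lookup v′ j)  ∎)

  module _ (v : Vec (Fin m) m) where

    private
      σ = toFun v

      σ-involutive-at : ∀ j → lookup v (lookup v j) ≡ j → σ (σ (toℕ j)) ≡ toℕ j
      σ-involutive-at j vvj≡j = begin
        σ (σ (toℕ j))                ≡⟨ cong σ (toFun-lookup v j) ⟩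
        σ (toℕ (lookup v j))         ≡⟨ toFun-lookup v (lookup v j) ⟩
        toℕ (lookup v (lookup v j))  ≡⟨ cong toℕ vvj≡j ⟩
        toℕ j                        ∎

    isMatching⇒IsMatching : T (isMatching v) → IsMatching σ
    isMatching⇒IsMatching h = record
      { bounded       = λ i<m → case toℕ-onto i<m of λ where
          (j , refl) → subst (_< m) (sym (toFun-lookup v j)) (toℕ<n (lookup v j))
      ; fixpoint-free = λ i<m → case toℕ-onto i<m of λ where
          (j , refl) σj≡j → proj₂ (matched j) (toℕ-injective (trans (sym (toFun-lookup v j)) σj≡j))
      ; involutive    = λ i<m → case toℕ-onto i<m of λ where
          (j , refl) → σ-involutive-at j (proj₁ (matched j))
      }
      where
      matched : ∀ j → lookup v (lookup v j) ≡ j × lookup v j ≢ j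
      matched j =
        let vvj≡j , ¬vj≢j = True-∧⁻ (lookup v (lookup v j) ≟ᶠ j)
                              (All.lookup (all⁺ _ (allFin m) h) (∈-allFin j))
        in vvj≡j , toWitnessFalse ¬vj≢j

    IsMatching⇒isMatching : IsMatching σ → T (isMatching v)
    IsMatching⇒isMatching matching =
      all⁻ (λ i → ⌊ lookup v (lookup v i) ≟ᶠ i ⌋ ∧ not ⌊ lookup v i ≟ᶠ i ⌋) (All.tabulate {xs = allFin m}
        λ {j} _ → True-∧⁺ (lookup v (lookup v j) ≟ᶠ j) (vvj≡j j) (fromWitnessFalse (vj≢j j)))
      where
      open IsMatching matching
      vvj≡j : ∀ j → lookup v (lookup v j) ≡ j
      vvj≡j j = toℕ-injective (begin
        toℕ (lookup v (lookup v j))  ≡⟨ toFun-lookup v (lookup v j) ⟨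
        σ (toℕ (lookup v j))         ≡⟨ cong σ (toFun-lookup v j) ⟨
        σ (σ (toℕ j))                ≡⟨ involutive (toℕ<n j) ⟩
        toℕ j                        ∎)
      vj≢j : ∀ j → lookup v j ≢ j
      vj≢j j vj≡j = fixpoint-free (toℕ<n j) (trans (toFun-lookup v j) (cong toℕ vj≡j))

    crossing-at : ∀ {a b} → a < m → b < m → DistantCrossing 2 a (σ a) b (σ b) →
                  T (hasKDistantCrossing 2 v)
    crossing-at a<m b<m crossing with toℕ-onto a<m | toℕ-onto b<m
    ... | ja , refl | jb , refl =
      any⁺ _ (lose (∈-allFin ja) (any⁺ _ (lose (∈-allFin jb) (kDistantCrossingAt⁺ 2 v ja jb
        (subst₂ (λ j₁ j₂ → DistantCrossing 2 (toℕ ja) j₁ (toℕ jb) j₂)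
                (toFun-lookup v ja) (toFun-lookup v jb) crossing)))))

    Noncrossing₂⇒¬crossing : IsMatching σ → Noncrossing₂ σ → ¬ T (hasKDistantCrossing 2 v)
    Noncrossing₂⇒¬crossing matching noncrossing h with satisfied (any⁻ _ (allFin m) h)
    ... | ja , h₁ with satisfied (any⁻ _ (allFin m) h₁)
    ... | jb , h₂ with kDistantCrossingAt⁻ 2 v ja jb h₂
    ... | _ , i₂<j₂ , i₁<i₂ , i₂≤j₁ , j₁<j₂ , 2≤j₁∸i₂ =
      ≤⇒≯ (noncrossing e₁ (toℕ<n (lookup v ja)) i₁<i₂ (≤∧≢⇒< i₂≤j₁ i₂≢j₁) (subst (_ <_) (sym e₂) j₁<j₂))
          (m≤o∸n⇒m+n≤o 2 i₂≤j₁ 2≤j₁∸i₂)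
      where
      open IsMatching matching
      e₁ = toFun-lookup v ja
      e₂ = toFun-lookup v jb
      i₂≢j₁ : toℕ jb ≢ toℕ (lookup v ja)
      i₂≢j₁ i₂≡j₁ = <-asym i₁<i₂ (subst (toℕ jb <_) σi₂≡i₁ (subst (_ <_) (sym e₂) i₂<j₂))
        where σi₂≡i₁ = trans (cong σ i₂≡j₁) (Involution.partner-sym {σ} involutive (toℕ<n ja) e₁)

    ¬crossing⇒Noncrossing₂ : ¬ T (hasKDistantCrossing 2 v) → Noncrossing₂ σ
    ¬crossing⇒Noncrossing₂ noCrossing {a} {b} refl c<m a<b b<c c<σb with σ a ≤? suc b
    ... | yes c≤b+1 = c≤b+1
    ... | no c≰b+1  = ⊥-elim (noCrossing (crossing-at (<-trans a<b b<m) b<m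
          (<-trans a<b b<c , <-trans b<c c<σb , a<b , <⇒≤ b<c , c<σb , m+n≤o⇒m≤o∸n 2 (≰⇒> c≰b+1))))
      where b<m = <-trans b<c c<m

  isKNoncrossingMatching⇒Scan : ∀ v → T (isKNoncrossingMatching 2 v) →
                                Scan (toFun v) 0 [] (encode (toFun v) 0 m)
  isKNoncrossingMatching⇒Scan v h =
    let matching , noCrossing = Equivalence.to T-∧ h
    in encode-Scan (isMatching⇒IsMatching v matching)
                   (¬crossing⇒Noncrossing₂ v (Equivalence.to T-not noCrossing))

  Scan⇒isKNoncrossingMatching : ∀ v {w} → Scan (toFun v) 0 [] w → T (isKNoncrossingMatching 2 v)
  Scan⇒isKNoncrossingMatching v r =
    Equivalence.from T-∧ (IsMatching⇒isMatching v matching ,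
      Equivalence.from T-not (Noncrossing₂⇒¬crossing v matching (Scan⇒Noncrossing₂ r)))
    where matching = Scan⇒IsMatching r

  Scan-fromFun : ∀ {σ w} → Scan σ 0 [] w → Scan (toFun (fromFun σ)) 0 [] w
  Scan-fromFun {σ} r = Scan-cong agree r
    where
    agree : ∀ {i} → Zone 0 [] i → σ i ≡ toFun (fromFun σ) i
    agree (inj₁ (_ , i<m)) = sym (toFun-fromFun σ i<m (IsMatching.bounded (Scan⇒IsMatching r) i<m))

  encode-injective : ∀ v v′ → T (isKNoncrossingMatching 2 v) → T (isKNoncrossingMatching 2 v′) →
                     encode (toFun v) 0 m ≡ encode (toFun v′) 0 m → v ≡ v′
  encode-injective v v′ h h′ same = toFun-injective λ i<m →
    Scan-injective (isKNoncrossingMatching⇒Scan v h)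
      (subst (Scan (toFun v′) 0 []) (sym same) (isKNoncrossingMatching⇒Scan v′ h′)) (inj₁ (z≤n , i<m))

  encode-path : ∀ v → T (isKNoncrossingMatching 2 v) →
                width (encode (toFun v) 0 m) ≡ m × T (validFrom 0 (encode (toFun v) 0 m))
  encode-path v h = trans (sym (+-identityʳ _)) (Scan⇒width r) , Scan⇒validFrom r
    where r = isKNoncrossingMatching⇒Scan v h

  encode-onto : ∀ {w} → width w ≡ m → T (validFrom 0 w) →
                ∃[ v ] T (isKNoncrossingMatching 2 v) × encode (toFun v) 0 m ≡ w
  encode-onto {w} width≡m valid with Scan-exists w valid [] (trans (+-identityʳ _) width≡m)
  ... | σ , r = fromFun σ , Scan⇒isKNoncrossingMatching (fromFun σ) (Scan-fromFun r) ,
                trans (cong (encode (toFun (fromFun σ)) 0) (sym width≡m)) (Scan⇒encode (Scan-fromFun r))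

mainTheorem3 : (n : ℕ) → NCM 2 (n + n) ≡ littleSchroder n
mainTheorem3 n =
  length-filterᵇ-bijection (isKNoncrossingMatching 2) (isSchroderPath n) (λ v → encode (toFun v) 0 m)
    encode-injective (allVecs-unique m m) (candidates-unique m) (allVecs-complete m m)
    (λ w h → subst (λ l → w ∈ candidates l) (proj₁ (True-∧⁻ (width w ≟ m) h)) (∈-candidates w))
    (λ v h → let width≡m , valid = encode-path v h in True-∧⁺ (_ ≟ m) width≡m valid)
    (λ w h → let width≡m , valid = True-∧⁻ (width w ≟ m) h in encode-onto width≡m valid)
  where
  m = n + n
  open Scanning m
  open Bridge m
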